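{- For all integers $n>k\geq 1$, \[ \gamma_{\times k}^{r}(K_n)=\begin{cases} n & \text{if } n\leq 2k,\\ k & \text{otherwise.}\end{cases} \]
   Context: All graphs are finite, simple and undirected; $K_n$ is the complete graph on $n$ vertices. For a graph $G=(V,E)$ and $x\in V$, $N(x)$ is the open neighborhood and $N[x]=N(x)\cup\{x\}$ the closed neighborhood. Let $k\geq 1$ be an integer and let $G$ have minimum degree $\delta(G)\geq k-1$. A set $S\subseteq V$ is a $k$-tuple dominating set if $|N[x]\cap S|\geq k$ for every $x\in V$. A $k$-tuple restrained dominating set (kRDS) is a $k$-tuple dominating set $S$ such that every vertex of $V-S$ is adjacent to at least $k$ vertices of $V-S$. The $k$-tuple restrained domination number $\gamma_{\times k}^{r}(G)$ is the minimum cardinality of a kRDS of $G$. -}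

module Defs where

open import Data.Nat using (ℕ; _≥_)
open import Data.Bool using (Bool; true; false; not; _∨_)
open import Data.Fin using (Fin)
open import Data.Fin.Properties using (_≟_)
open import Data.Fin.Subset using (Subset; _∈_; _∉_; _∩_; ∣_∣)
open import Data.Vec using (tabulate)
open import Data.Product using (Σ; _×_)
open import Relation.Nullary.Decidable using (⌊_⌋)
open import Relation.Binary.PropositionalEquality using (_≡_)

record Graph (n : ℕ) : Set where
  field
    adj     : Fin n → Fin n → Bool
    adj-sym : ∀ x y → adj x y ≡ adj y x
    adj-irr : ∀ x → adj x x ≡ false
open Graph public

N : ∀ {n} → Graph n → Fin n → Subset n
N G x = tabulate (λ y → adj G x y)

N[_] : ∀ {n} → Graph n → Fin n → Subset n
N[ G ] x = tabulate (λ y → ⌊ x ≟ y ⌋ ∨ adj G x y)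

MinDegreeAtLeast : ∀ {n} → Graph n → ℕ → Set
MinDegreeAtLeast G d = ∀ x → ∣ N G x ∣ ≥ d

K : (n : ℕ) → Graph n
K n = record
  { adj     = λ x y → not ⌊ x ≟ y ⌋
  ; adj-sym = sym'
  ; adj-irr = irr }
  where
  open import Relation.Binary.PropositionalEquality using (refl; sym)
  open import Relation.Nullary using (yes; no)
  sym' : ∀ x y → not ⌊ x ≟ y ⌋ ≡ not ⌊ y ≟ x ⌋
  sym' x y with x ≟ y | y ≟ x
  ... | yes _ | yes _ = refl
  ... | no _  | no _  = refl
  ... | yes p | no q  = Data.Empty.⊥-elim (q (sym p))
    where import Data.Empty
  ... | no p  | yes q = Data.Empty.⊥-elim (p (sym q))
    where import Data.Empty
  irr : ∀ x → not ⌊ x ≟ x ⌋ ≡ false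
  irr x with x ≟ x
  ... | yes _ = refl
  ... | no ¬p = Data.Empty.⊥-elim (¬p refl)
    where import Data.Empty

IsKTupleDom : ∀ {n} → Graph n → ℕ → Subset n → Set
IsKTupleDom G k S = ∀ x → ∣ N[ G ] x ∩ S ∣ ≥ k

IsKRDS : ∀ {n} → Graph n → ℕ → Subset n → Set
IsKRDS G k S =
  IsKTupleDom G k S ×
  (∀ x → x ∉ S → ∣ N G x ∩ Data.Fin.Subset.∁ S ∣ ≥ k)

IsKRDNumber : ∀ {n} → Graph n → ℕ → ℕ → Set
IsKRDNumber {n} G k m =
  Σ (Subset n) (λ S → IsKRDS G k S × ∣ S ∣ ≡ m) ×
  (∀ S → IsKRDS G k S → ∣ S ∣ ≥ m)

-- In K_n every closed neighbourhood is the whole vertex set, so S is k-tuple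
-- dominating iff |S| ≥ k; and for x ∉ S the set N(x) ∩ (V − S) is (V − S) minus x,
-- so the restraint condition says |V − S| ≥ k + 1 unless S = V. Hence a kRDS
-- other than V has k + (k + 1) ≤ |S| + |V − S| = n: for n ≤ 2k only V remains,
-- while for n > 2k any k vertices form a kRDS and k is a lower bound anyway.
module Submission where

open import Defs
open import Data.Nat using (ℕ; suc; _+_; _*_; _∸_; _≤_; _<_; z≤n; s≤s)
open import Data.Nat.Properties
  using (≤-refl; ≤-reflexive; <⇒≤; ≤-pred; +-suc; +-identityʳ; +-mono-≤; m+[n∸m]≡n; m+n≤o⇒m≤o∸n; ≰⇒>; <⇒≱; module ≤-Reasoning)
open import Data.Bool using (true; false; not; _∨_)
open import Data.Bool.Properties using (∨-inverseʳ)
open import Data.Fin using (Fin; zero; suc; fromℕ<)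
open import Data.Fin.Properties using (_≟_; all?; ¬∀⟶∃¬)
open import Data.Fin.Subset using (Subset; _∈_; _∉_; _∩_; ⁅_⁆; ∣_∣; ∁; ⊤; ⊥; inside; outside)
open import Data.Fin.Subset.Properties
  using (_∈?_; ∣⊤∣≡n; ∣⊥∣≡0; ∣∁p∣≡n∸∣p∣; ∣p∣≤n; p⊆q⇒∣p∣≤∣q∣; ∩-identityˡ; drop-there; x∉p⇒x∈∁p; ∈⊤)
open import Data.Vec using (_∷_; here; tabulate; replicate)
open import Data.Vec.Properties using (tabulate-cong; tabulate-∘; map-const; map-replicate)
open import Data.Product using (Σ; _×_; _,_)
open import Data.Empty using (⊥-elim)
open import Function using (const; id)
open import Relation.Nullary using (¬_; yes; no)
open import Relation.Nullary.Decidable using (⌊_⌋)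
open import Relation.Binary.PropositionalEquality using (_≡_; refl; sym; trans; cong; subst)

∣p∣+∣∁p∣≡n : ∀ {n} (p : Subset n) → ∣ p ∣ + ∣ ∁ p ∣ ≡ n
∣p∣+∣∁p∣≡n {n} p = trans (cong (∣ p ∣ +_) (∣∁p∣≡n∸∣p∣ p)) (m+[n∸m]≡n (∣p∣≤n p))

tabulate-const : ∀ {a} {A : Set a} {n} (v : A) → tabulate {n = n} (const v) ≡ replicate n v
tabulate-const v = trans (tabulate-∘ (const v) id) (map-const _ v)

∁⊥≡⊤ : ∀ {n} → ∁ ⊥ ≡ ⊤ {n}
∁⊥≡⊤ {n} = map-replicate not outside n

x∈p⇒∣p∣≡1+∣∁⁅x⁆∩p∣ : ∀ {n} {x : Fin n} {p : Subset n} → x ∈ p → ∣ p ∣ ≡ suc ∣ ∁ ⁅ x ⁆ ∩ p ∣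
x∈p⇒∣p∣≡1+∣∁⁅x⁆∩p∣ {x = zero}  {inside ∷ p}  here =
  cong suc (sym (trans (cong (λ q → ∣ q ∩ p ∣) ∁⊥≡⊤) (cong ∣_∣ (∩-identityˡ p))))
x∈p⇒∣p∣≡1+∣∁⁅x⁆∩p∣ {x = suc x} {inside ∷ p}  x∈p = cong suc (x∈p⇒∣p∣≡1+∣∁⁅x⁆∩p∣ (drop-there x∈p))
x∈p⇒∣p∣≡1+∣∁⁅x⁆∩p∣ {x = suc x} {outside ∷ p} x∈p = x∈p⇒∣p∣≡1+∣∁⁅x⁆∩p∣ (drop-there x∈p)

∃-subset-of-size : ∀ {k n} → k ≤ n → Σ (Subset n) (λ S → ∣ S ∣ ≡ k)
∃-subset-of-size (z≤n {n}) = ⊥ , ∣⊥∣≡0 n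
∃-subset-of-size (s≤s k≤n) with ∃-subset-of-size k≤n
... | S , ∣S∣≡k = inside ∷ S , cong suc ∣S∣≡k

N[K]x≡⊤ : ∀ {n} (x : Fin n) → N[ K n ] x ≡ ⊤
N[K]x≡⊤ x = trans (tabulate-cong (λ y → ∨-inverseʳ ⌊ x ≟ y ⌋)) (tabulate-const true)

NKx≡∁⁅x⁆ : ∀ {n} (x : Fin n) → N (K n) x ≡ ∁ ⁅ x ⁆
NKx≡∁⁅x⁆ zero    = cong (false ∷_) (trans (tabulate-const true) (sym ∁⊥≡⊤))
NKx≡∁⁅x⁆ (suc x) = cong (true ∷_) (trans (tabulate-cong (suc≟suc x)) (NKx≡∁⁅x⁆ x))
  where
  suc≟suc : ∀ {n} (x y : Fin n) → not ⌊ suc x ≟ suc y ⌋ ≡ not ⌊ x ≟ y ⌋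
  suc≟suc x y with x ≟ y
  ... | yes _ = refl
  ... | no _  = refl

∣N[K]x∩p∣≡∣p∣ : ∀ {n} (x : Fin n) (p : Subset n) → ∣ N[ K n ] x ∩ p ∣ ≡ ∣ p ∣
∣N[K]x∩p∣≡∣p∣ x p = cong ∣_∣ (trans (cong (_∩ p) (N[K]x≡⊤ x)) (∩-identityˡ p))

x∈p⇒∣p∣≡1+∣NKx∩p∣ : ∀ {n} {x : Fin n} {p : Subset n} → x ∈ p → ∣ p ∣ ≡ suc ∣ N (K n) x ∩ p ∣
x∈p⇒∣p∣≡1+∣NKx∩p∣ {x = x} {p} x∈p =
  trans (x∈p⇒∣p∣≡1+∣∁⁅x⁆∩p∣ x∈p) (cong (λ q → suc ∣ q ∩ p ∣) (sym (NKx≡∁⁅x⁆ x)))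

isKTupleDom-K : ∀ {n k} {S : Subset n} → k ≤ ∣ S ∣ → IsKTupleDom (K n) k S
isKTupleDom-K {S = S} k≤∣S∣ x = subst (_ ≤_) (sym (∣N[K]x∩p∣≡∣p∣ x S)) k≤∣S∣

isKTupleDom-K⁻ : ∀ {n k} {S : Subset n} → IsKTupleDom (K n) k S → Fin n → k ≤ ∣ S ∣
isKTupleDom-K⁻ {S = S} dom x = subst (_ ≤_) (∣N[K]x∩p∣≡∣p∣ x S) (dom x)

restrained-K : ∀ {n k} {S : Subset n} → k < ∣ ∁ S ∣ → ∀ x → x ∉ S → k ≤ ∣ N (K n) x ∩ ∁ S ∣
restrained-K k<∣∁S∣ x x∉S = ≤-pred (subst (_ <_) (x∈p⇒∣p∣≡1+∣NKx∩p∣ (x∉p⇒x∈∁p x∉S)) k<∣∁S∣)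

restrained-K⁻ : ∀ {n k} {S : Subset n} {x : Fin n} → x ∉ S → k ≤ ∣ N (K n) x ∩ ∁ S ∣ → k < ∣ ∁ S ∣
restrained-K⁻ x∉S k≤ = subst (_ <_) (sym (x∈p⇒∣p∣≡1+∣NKx∩p∣ (x∉p⇒x∈∁p x∉S))) (s≤s k≤)

⊤-isKRDS-K : ∀ {n k} → k ≤ n → IsKRDS (K n) k ⊤
⊤-isKRDS-K {n} k≤n = isKTupleDom-K (subst (_ ≤_) (sym (∣⊤∣≡n n)) k≤n) , λ x x∉⊤ → ⊥-elim (x∉⊤ ∈⊤)

1+2k≡k+[1+k] : ∀ k → suc (2 * k) ≡ k + suc k
1+2k≡k+[1+k] k = trans (cong (λ m → suc (k + m)) (+-identityʳ k)) (sym (+-suc k k))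

isKRDS-K-of-size : ∀ {n k} {S : Subset n} → 2 * k < n → ∣ S ∣ ≡ k → IsKRDS (K n) k S
isKRDS-K-of-size {n} {k} {S} 2k<n ∣S∣≡k =
  isKTupleDom-K (subst (k ≤_) (sym ∣S∣≡k) ≤-refl) , restrained-K k<∣∁S∣
  where
  k<∣∁S∣ : k < ∣ ∁ S ∣
  k<∣∁S∣ = subst (suc k ≤_) (sym (trans (∣∁p∣≡n∸∣p∣ S) (cong (n ∸_) ∣S∣≡k)))
             (m+n≤o⇒m≤o∸n (suc k) (subst (λ m → suc (k + m) ≤ n) (+-identityʳ k) 2k<n))

isKRDS-K-nonfull⇒2k<n : ∀ {n k} {S : Subset n} {x : Fin n} → IsKRDS (K n) k S → x ∉ S → 2 * k < n
isKRDS-K-nonfull⇒2k<n {n} {k} {S} {x} (dom , res) x∉S = begin-strict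
  2 * k           <⟨ ≤-reflexive (1+2k≡k+[1+k] k) ⟩
  k + suc k       ≤⟨ +-mono-≤ (isKTupleDom-K⁻ dom x) (restrained-K⁻ x∉S (res x x∉S)) ⟩
  ∣ S ∣ + ∣ ∁ S ∣ ≡⟨ ∣p∣+∣∁p∣≡n S ⟩
  n               ∎
  where open ≤-Reasoning

n≤2k⇒isKRDS-K-full : ∀ {n k} {S : Subset n} → n ≤ 2 * k → IsKRDS (K n) k S → n ≤ ∣ S ∣
n≤2k⇒isKRDS-K-full {n} {S = S} n≤2k krds with all? (_∈? S)
... | yes all∈S = subst (_≤ ∣ S ∣) (∣⊤∣≡n n) (p⊆q⇒∣p∣≤∣q∣ {p = ⊤} (λ {x} _ → all∈S x))
... | no ¬all∈S with ¬∀⟶∃¬ n (_∈ S) (_∈? S) ¬all∈S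
...   | x , x∉S = ⊥-elim (<⇒≱ (isKRDS-K-nonfull⇒2k<n krds x∉S) n≤2k)

proposition2p2 : (n k : ℕ) → 1 ≤ k → k < n →
    (n ≤ 2 * k → IsKRDNumber (K n) k n) ×
    (¬ (n ≤ 2 * k) → IsKRDNumber (K n) k k)
proposition2p2 n k _ k<n = small , large
  where
  small : n ≤ 2 * k → IsKRDNumber (K n) k n
  small n≤2k = (⊤ , ⊤-isKRDS-K (<⇒≤ k<n) , ∣⊤∣≡n n) , λ _ → n≤2k⇒isKRDS-K-full n≤2k

  large : ¬ (n ≤ 2 * k) → IsKRDNumber (K n) k k
  large n≰2k with ∃-subset-of-size (<⇒≤ k<n)
  ... | S , ∣S∣≡k = (S , isKRDS-K-of-size (≰⇒> n≰2k) ∣S∣≡k , ∣S∣≡k) ,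
                    λ { _ (dom , _) → isKTupleDom-K⁻ dom (fromℕ< k<n) }
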